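{- Let $M=(E,\rho)$ be a matroid of rank $d\ge1$. For $0\le k\le d$, the number of $k$-element independent sets of $M$ equals $[p^kt^{d-k}]\,Y_M(1-p,t)$.
   Context: The corank function is $\sigma(S)=\#S-\rho(S)$ and $d=\rho(E)$. The Tutte polynomial is $T_M(x,y)=\sum_{S\subseteq E}(x-1)^{\rho(E)-\rho(S)}(y-1)^{\sigma(S)}$, and $Y_M(q,t):=(1-q)^{\rho(E)}q^{\sigma(E)}T_M\!\left(\frac{qt+1-q}{1-q},\frac1q\right)$ (a polynomial). $[p^at^b]F$ is the coefficient of $p^at^b$ in $F$. -}

module Defs where

open import Data.Nat as ℕ using (ℕ; zero; suc; _∸_; _≤_)
open import Data.Integer as ℤ using (ℤ; +_)
open import Data.Bool using (Bool; true; false; if_then_else_)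
open import Data.List using (List; []; _∷_; map; _++_; foldr; length; filter)
open import Data.Vec using (Vec; []; _∷_)
open import Data.Fin.Subset using (Subset; _⊆_; _∪_; _∩_; ∣_∣; ⊤)
open import Relation.Nullary.Decidable using (_×-dec_)
open import Data.Product using (_×_)
open import Relation.Binary.PropositionalEquality using (_≡_)

record Matroid (n : ℕ) : Set where
  field
    ρ          : Subset n → ℕ
    ρ-bounded  : ∀ S → ρ S ≤ ∣ S ∣
    ρ-mono     : ∀ {S T} → S ⊆ T → ρ S ≤ ρ T
    ρ-submod   : ∀ S T → ρ (S ∪ T) ℕ.+ ρ (S ∩ T) ≤ ρ S ℕ.+ ρ T

open Matroid public

E : ∀ {n} → Subset n
E = ⊤

rank : ∀ {n} → Matroid n → ℕ
rank M = ρ M E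

σ : ∀ {n} → Matroid n → Subset n → ℕ
σ M S = ∣ S ∣ ∸ ρ M S

allSubsets : (n : ℕ) → List (Subset n)
allSubsets zero    = [] ∷ []
allSubsets (suc n) = map (false ∷_) (allSubsets n) ++ map (true ∷_) (allSubsets n)

Independent : ∀ {n} → Matroid n → Subset n → Set
Independent M S = ρ M S ≡ ∣ S ∣

numIndep : ∀ {n} → Matroid n → ℕ → ℕ
numIndep {n} M k =
  length (filter (λ S → (∣ S ∣ ℕ.≟ k) ×-dec (ρ M S ℕ.≟ ∣ S ∣)) (allSubsets n))

-- Formal power series in two variables (p, t) over ℤ:
-- a series is its coefficient function, f i j = [p^i t^j] f.

Series : Set
Series = ℕ → ℕ → ℤ

sumTo : ℕ → (ℕ → ℤ) → ℤ
sumTo zero    f = f 0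
sumTo (suc m) f = sumTo m f ℤ.+ f (suc m)

const : ℤ → Series
const c zero zero = c
const c _    _    = + 0

varP : Series
varP 1    zero = + 1
varP _    _    = + 0

varT : Series
varT zero 1 = + 1
varT _    _ = + 0

_⊕_ : Series → Series → Series
(f ⊕ g) i j = f i j ℤ.+ g i j

_⊖_ : Series → Series → Series
(f ⊖ g) i j = f i j ℤ.- g i j

_⊗_ : Series → Series → Series
(f ⊗ g) i j = sumTo i (λ a → sumTo j (λ b → f a b ℤ.* g (i ∸ a) (j ∸ b)))

_^^_ : Series → ℕ → Series
f ^^ zero  = const (+ 1)
f ^^ suc m = f ⊗ (f ^^ m)

infixl 6 _⊕_ _⊖_
infixl 7 _⊗_
infixr 8 _^^_

coeff : ℕ → ℕ → Series → ℤ
coeff a b F = F a b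

-- Y_M(q,t) := (1-q)^{ρ(E)} q^{σ(E)} T_M((qt+1-q)/(1-q), 1/q), where
-- T_M(x,y) = Σ_S (x-1)^{ρ(E)-ρ(S)} (y-1)^{σ(S)}.
-- With x-1 = qt/(1-q) and y-1 = (1-q)/q, the prefactor is distributed
-- over each summand and the denominators cleared (ρ(E)-ρ(S) ≤ ρ(E) and
-- σ(S) ≤ σ(E)), giving the polynomial
--   Y_M(q,t) = Σ_S (1-q)^{ρ(E)-(ρ(E)-ρ(S))} (qt)^{ρ(E)-ρ(S)}
--                  q^{σ(E)-σ(S)} (1-q)^{σ(S)}.

Y : ∀ {n} → Matroid n → Series → Series → Series
Y {n} M q t = foldr _⊕_ (const (+ 0)) (map term (allSubsets n))
  where
    d = rank M
    one-q = const (+ 1) ⊖ q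
    term : Subset n → Series
    term S = (one-q ^^ (d ∸ (d ∸ ρ M S))) ⊗ ((q ⊗ t) ^^ (d ∸ ρ M S))
             ⊗ (q ^^ (σ M E ∸ σ M S)) ⊗ (one-q ^^ σ M S)

{-# OPTIONS --safe #-}
-- With q = 1 - p the summand of Y_M for S is
--   p^ρ(S) ((1-p)t)^(d-ρ(S)) (1-p)^(σ(E)-σ(S)) p^σ(S),
-- which is homogeneous of degree d - ρ(S) in t, and whose lowest power of p
-- is p^(ρ(S)+σ(S)) = p^|S|, with coefficient 1.  Hence its coefficient of
-- p^k t^(d-k) vanishes unless ρ(S) = k ≥ |S|, i.e. unless S is an independent
-- k-set, in which case it is 1.
module Submission where

open import Defs
open import Data.Nat using (ℕ; _≤_; _∸_)
open import Data.Integer using (+_)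
open import Relation.Binary.PropositionalEquality using (_≡_)

open import Data.Nat as ℕ using (zero; suc; _+_; z≤n; s≤s)
open import Data.Nat.Properties
  using (≤-refl; ≤-antisym; ≤-pred; ≤∧≢⇒<; <⇒≢; m≤n⇒m≤1+n; m≤m+n; +-identityʳ; +-mono-≤;
         +-monoʳ-≤; +-cancelʳ-≤; m+n∸m≡n; m+[n∸m]≡n; m∸[m∸n]≡n; ∸-cancelˡ-≡; *-identityʳ; *-zeroʳ)
open import Data.Integer as ℤ using (ℤ; 0ℤ; 1ℤ)
import Data.Integer.Properties as ℤ
open import Data.List using ([]; _∷_; map; foldr; length; filter)
open import Data.Fin.Subset using (Subset; ∣_∣)
open import Data.Fin.Subset.Properties using (⊆⊤)
open import Data.Product using (_×_; _,_; ∃-syntax)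
open import Function using (_∘_)
open import Relation.Nullary using (¬_; Dec; yes; no; contradiction)
open import Relation.Nullary.Decidable using (_×-dec_; decidable-stable)
open import Relation.Unary using (Pred; Decidable)
open import Relation.Binary.PropositionalEquality
  using (_≢_; refl; sym; trans; cong; cong₂; subst; subst₂; module ≡-Reasoning)

vanishes-unless : ∀ {p} {P : Set p} {x : ℤ} → (x ≢ 0ℤ → P) → ¬ P → x ≡ 0ℤ
vanishes-unless {x = x} x≢0⇒P ¬P = decidable-stable (x ℤ.≟ 0ℤ) (¬P ∘ x≢0⇒P)

*-nonzero⇒nonzero : ∀ {x y : ℤ} → x ℤ.* y ≢ 0ℤ → x ≢ 0ℤ × y ≢ 0ℤ
*-nonzero⇒nonzero {x} {y} xy≢0 =
  (λ x≡0 → xy≢0 (trans (cong (ℤ._* y) x≡0) (ℤ.*-zeroˡ y))) ,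
  (λ y≡0 → xy≢0 (trans (cong (x ℤ.*_) y≡0) (ℤ.*-zeroʳ x)))

sumTo-nonzero : ∀ n (g : ℕ → ℤ) → sumTo n g ≢ 0ℤ → ∃[ x ] x ≤ n × g x ≢ 0ℤ
sumTo-nonzero zero    g g0≢0 = 0 , z≤n , g0≢0
sumTo-nonzero (suc n) g sum≢0 with g (suc n) ℤ.≟ 0ℤ
... | no  g≢0 = suc n , ≤-refl , g≢0
... | yes g≡0 with sumTo-nonzero n g (λ s≡0 → sum≢0 (cong₂ ℤ._+_ s≡0 g≡0))
...   | x , x≤n , gx≢0 = x , m≤n⇒m≤1+n x≤n , gx≢0

sumTo-concentrated : ∀ n (g : ℕ → ℤ) {c} → c ≤ n →
                     (∀ x → x ≤ n → g x ≢ 0ℤ → x ≡ c) → sumTo n g ≡ g c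
sumTo-concentrated zero    g z≤n _ = refl
sumTo-concentrated (suc n) g {c} c≤1+n only-c with c ℕ.≟ suc n
... | yes refl = trans (cong (ℤ._+ g (suc n)) rest≡0) (ℤ.+-identityˡ (g (suc n)))
  where
  rest≡0 : sumTo n g ≡ 0ℤ
  rest≡0 = vanishes-unless (sumTo-nonzero n g) λ (x , x≤n , gx≢0) →
    <⇒≢ (s≤s x≤n) (only-c x (m≤n⇒m≤1+n x≤n) gx≢0)
... | no c≢1+n = trans (cong₂ ℤ._+_ rest≡gc last≡0) (ℤ.+-identityʳ (g c))
  where
  rest≡gc : sumTo n g ≡ g c
  rest≡gc = sumTo-concentrated n g (≤-pred (≤∧≢⇒< c≤1+n c≢1+n))
              (λ x x≤n → only-c x (m≤n⇒m≤1+n x≤n))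
  last≡0 : g (suc n) ≡ 0ℤ
  last≡0 = vanishes-unless (only-c (suc n) ≤-refl) (c≢1+n ∘ sym)

record LowestTerm (a m : ℕ) (f : Series) : Set where
  field
    support : ∀ {i j} → f i j ≢ 0ℤ → j ≡ m × a ≤ i
    leading : f a m ≡ 1ℤ

open LowestTerm

module _ {a b m m' : ℕ} {f h : Series} (F : LowestTerm a m f) (H : LowestTerm b m' h) where

  private
    summand-support : ∀ {i j a' b'} → f a' b' ℤ.* h (i ∸ a') (j ∸ b') ≢ 0ℤ →
                      (b' ≡ m × a ≤ a') × (j ∸ b' ≡ m' × b ≤ i ∸ a')
    summand-support summand≢0 =
      let fa'b'≢0 , h≢0 = *-nonzero⇒nonzero summand≢0 in support F fa'b'≢0 , support H h≢0

    nonzero-summand : ∀ {i j} → (f ⊗ h) i j ≢ 0ℤ →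
                      ∃[ a' ] ∃[ b' ] a' ≤ i × b' ≤ j × f a' b' ℤ.* h (i ∸ a') (j ∸ b') ≢ 0ℤ
    nonzero-summand {i} {j} fh≢0 with sumTo-nonzero i _ fh≢0
    ... | a' , a'≤i , inner≢0 with sumTo-nonzero j _ inner≢0
    ...   | b' , b'≤j , summand≢0 = a' , b' , a'≤i , b'≤j , summand≢0

  ⊗-lowestTerm : LowestTerm (a + b) (m + m') (f ⊗ h)
  support ⊗-lowestTerm fh≢0 with nonzero-summand fh≢0
  ... | a' , b' , a'≤i , b'≤j , summand≢0 with summand-support summand≢0
  ...   | (b'≡m , a≤a') , (j∸b'≡m' , b≤i∸a') =
    trans (sym (m+[n∸m]≡n b'≤j)) (cong₂ _+_ b'≡m j∸b'≡m') ,
    subst (a + b ≤_) (m+[n∸m]≡n a'≤i) (+-mono-≤ a≤a' b≤i∸a')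
  leading ⊗-lowestTerm = begin
    (f ⊗ h) (a + b) (m + m')
      ≡⟨ sumTo-concentrated (a + b) _ (m≤m+n a b) only-a ⟩
    sumTo (m + m') (λ b' → f a b' ℤ.* h (a + b ∸ a) (m + m' ∸ b'))
      ≡⟨ sumTo-concentrated (m + m') _ (m≤m+n m m') only-m ⟩
    f a m ℤ.* h (a + b ∸ a) (m + m' ∸ m)
      ≡⟨ cong₂ ℤ._*_ (leading F) (cong₂ h (m+n∸m≡n a b) (m+n∸m≡n m m')) ⟩
    1ℤ ℤ.* h b m'
      ≡⟨ ℤ.*-identityˡ (h b m') ⟩
    h b m'
      ≡⟨ leading H ⟩
    1ℤ ∎
    where
    open ≡-Reasoning
    only-a : ∀ a' → a' ≤ a + b →
             sumTo (m + m') (λ b' → f a' b' ℤ.* h (a + b ∸ a') (m + m' ∸ b')) ≢ 0ℤ → a' ≡ a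
    only-a a' a'≤a+b inner≢0 with sumTo-nonzero (m + m') _ inner≢0
    ... | _ , _ , summand≢0 with summand-support summand≢0
    ...   | (_ , a≤a') , (_ , b≤a+b∸a') = ≤-antisym a'≤a a≤a'
      where
      a'≤a : a' ≤ a
      a'≤a = +-cancelʳ-≤ b a' a (subst (a' + b ≤_) (m+[n∸m]≡n a'≤a+b) (+-monoʳ-≤ a' b≤a+b∸a'))
    only-m : ∀ b' → b' ≤ m + m' → f a b' ℤ.* h (a + b ∸ a) (m + m' ∸ b') ≢ 0ℤ → b' ≡ m
    only-m b' _ summand≢0 = let (b'≡m , _) , _ = summand-support summand≢0 in b'≡m

const1-lowestTerm : LowestTerm 0 0 (const 1ℤ)
support const1-lowestTerm {j = zero}     _  = refl , z≤n
support const1-lowestTerm {zero}  {suc j} ≢0 = contradiction refl ≢0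
support const1-lowestTerm {suc i} {suc j} ≢0 = contradiction refl ≢0
leading const1-lowestTerm = refl

^^-lowestTerm : ∀ {a m f} → LowestTerm a m f →
                ∀ e → LowestTerm (e ℕ.* a) (e ℕ.* m) (f ^^ e)
^^-lowestTerm F zero    = const1-lowestTerm
^^-lowestTerm F (suc e) = ⊗-lowestTerm F (^^-lowestTerm F e)

q p : Series
q = const 1ℤ ⊖ varP
p = const 1ℤ ⊖ q

q-lowestTerm : LowestTerm 0 0 q
support q-lowestTerm {j = zero}               _  = refl , z≤n
support q-lowestTerm {zero}        {suc j} ≢0 = contradiction refl ≢0
support q-lowestTerm {suc zero}    {suc j} ≢0 = contradiction refl ≢0
support q-lowestTerm {suc (suc i)} {suc j} ≢0 = contradiction refl ≢0
leading q-lowestTerm = refl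

p-lowestTerm : LowestTerm 1 0 p
support p-lowestTerm {zero}        {zero}  ≢0 = contradiction refl ≢0
support p-lowestTerm {suc i}       {zero}  _  = refl , s≤s z≤n
support p-lowestTerm {zero}        {suc j} ≢0 = contradiction refl ≢0
support p-lowestTerm {suc zero}    {suc j} ≢0 = contradiction refl ≢0
support p-lowestTerm {suc (suc i)} {suc j} ≢0 = contradiction refl ≢0
leading p-lowestTerm = refl

t-lowestTerm : LowestTerm 0 1 varT
support t-lowestTerm {j = suc zero}        _  = refl , z≤n
support t-lowestTerm {zero}  {zero}        ≢0 = contradiction refl ≢0
support t-lowestTerm {suc i} {zero}        ≢0 = contradiction refl ≢0
support t-lowestTerm {zero}  {suc (suc j)} ≢0 = contradiction refl ≢0
support t-lowestTerm {suc i} {suc (suc j)} ≢0 = contradiction refl ≢0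
leading t-lowestTerm = refl

p^^-lowestTerm : ∀ e → LowestTerm e 0 (p ^^ e)
p^^-lowestTerm e = subst₂ (λ a m → LowestTerm a m (p ^^ e)) (*-identityʳ e) (*-zeroʳ e)
  (^^-lowestTerm p-lowestTerm e)

q^^-lowestTerm : ∀ e → LowestTerm 0 0 (q ^^ e)
q^^-lowestTerm e = subst₂ (λ a m → LowestTerm a m (q ^^ e)) (*-zeroʳ e) (*-zeroʳ e)
  (^^-lowestTerm q-lowestTerm e)

qt^^-lowestTerm : ∀ e → LowestTerm 0 e ((q ⊗ varT) ^^ e)
qt^^-lowestTerm e = subst₂ (λ a m → LowestTerm a m ((q ⊗ varT) ^^ e)) (*-zeroʳ e) (*-identityʳ e)
  (^^-lowestTerm (⊗-lowestTerm q-lowestTerm t-lowestTerm) e)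

indicator : ∀ {ℓ} {P : Set ℓ} → Dec P → ℤ
indicator (yes _) = 1ℤ
indicator (no _)  = 0ℤ

const0-coeff : ∀ i j → const 0ℤ i j ≡ 0ℤ
const0-coeff zero    zero    = refl
const0-coeff zero    (suc j) = refl
const0-coeff (suc i) j       = refl

module _ {a ℓ} {A : Set a} {P : Pred A ℓ} (P? : Decidable P) (f : A → Series) {i j : ℕ} where

  count≡coeff-sum : (∀ x → f x i j ≡ indicator (P? x)) →
                    ∀ xs → + length (filter P? xs) ≡ foldr _⊕_ (const 0ℤ) (map f xs) i j
  count≡coeff-sum f≡𝟙 []       = sym (const0-coeff i j)
  count≡coeff-sum f≡𝟙 (x ∷ xs) with P? x | f≡𝟙 x
  ... | yes _ | fx≡1 = cong₂ ℤ._+_ (sym fx≡1) (count≡coeff-sum f≡𝟙 xs)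
  ... | no _  | fx≡0 = begin
    + length (filter P? xs)  ≡⟨ count≡coeff-sum f≡𝟙 xs ⟩
    rest                     ≡⟨ ℤ.+-identityˡ rest ⟨
    0ℤ ℤ.+ rest              ≡⟨ cong (ℤ._+ rest) fx≡0 ⟨
    f x i j ℤ.+ rest         ∎
    where
    open ≡-Reasoning
    rest = foldr _⊕_ (const 0ℤ) (map f xs) i j

module _ {n} (M : Matroid n) where

  private
    d = rank M

  ρ≤rank : ∀ S → ρ M S ≤ d
  ρ≤rank S = ρ-mono M ⊆⊤

  -- Definitionally the summand of Y M q varT, so Y M q varT unfolds to a sum of these.
  Y-summand : Subset n → Series
  Y-summand S = (p ^^ (d ∸ (d ∸ ρ M S))) ⊗ ((q ⊗ varT) ^^ (d ∸ ρ M S))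
                ⊗ (q ^^ (σ M E ∸ σ M S)) ⊗ (p ^^ σ M S)

  Y-summand-lowestTerm : ∀ S → LowestTerm ∣ S ∣ (d ∸ ρ M S) (Y-summand S)
  Y-summand-lowestTerm S = subst₂ (λ a m → LowestTerm a m (Y-summand S)) p-degree t-degree
    (⊗-lowestTerm (⊗-lowestTerm (⊗-lowestTerm (p^^-lowestTerm (d ∸ (d ∸ ρ M S)))
                                              (qt^^-lowestTerm (d ∸ ρ M S)))
                                (q^^-lowestTerm (σ M E ∸ σ M S)))
                  (p^^-lowestTerm (σ M S)))
    where
    open ≡-Reasoning
    p-degree : d ∸ (d ∸ ρ M S) + 0 + 0 + σ M S ≡ ∣ S ∣
    p-degree = begin
      d ∸ (d ∸ ρ M S) + 0 + 0 + σ M S ≡⟨ cong (_+ σ M S) (trans (+-identityʳ _) (+-identityʳ _)) ⟩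
      d ∸ (d ∸ ρ M S) + σ M S         ≡⟨ cong (_+ σ M S) (m∸[m∸n]≡n (ρ≤rank S)) ⟩
      ρ M S + (∣ S ∣ ∸ ρ M S)         ≡⟨ m+[n∸m]≡n (ρ-bounded M S) ⟩
      ∣ S ∣                           ∎
    t-degree : d ∸ ρ M S + 0 + 0 ≡ d ∸ ρ M S
    t-degree = trans (+-identityʳ _) (+-identityʳ _)

  independent-of-size? : ∀ k → Decidable (λ S → ∣ S ∣ ≡ k × Independent M S)
  independent-of-size? k S = (∣ S ∣ ℕ.≟ k) ×-dec (ρ M S ℕ.≟ ∣ S ∣)

  Y-summand-coeff : ∀ {k} → k ≤ d → ∀ S →
                    Y-summand S k (d ∸ k) ≡ indicator (independent-of-size? k S)
  Y-summand-coeff {k} k≤d S with independent-of-size? k S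
  ... | yes (∣S∣≡k , ρ≡∣S∣) =
    subst₂ (λ i j → Y-summand S i j ≡ 1ℤ) ∣S∣≡k (cong (d ∸_) (trans ρ≡∣S∣ ∣S∣≡k))
      (leading (Y-summand-lowestTerm S))
  ... | no ¬indep-k = vanishes-unless support-k ¬indep-k
    where
    support-k : Y-summand S k (d ∸ k) ≢ 0ℤ → ∣ S ∣ ≡ k × Independent M S
    support-k ≢0 with support (Y-summand-lowestTerm S) ≢0
    ... | d∸k≡d∸ρ , ∣S∣≤k =
      let ρ≡k    = ∸-cancelˡ-≡ (ρ≤rank S) k≤d (sym d∸k≡d∸ρ)
          ∣S∣≡k  = ≤-antisym ∣S∣≤k (subst (_≤ ∣ S ∣) ρ≡k (ρ-bounded M S))
      in ∣S∣≡k , trans ρ≡k (sym ∣S∣≡k)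

corollary2p8 : (n : ℕ) (M : Matroid n) → 1 ≤ rank M → (k : ℕ) → k ≤ rank M →
    + numIndep M k ≡ coeff k (rank M ∸ k) (Y M (const (+ 1) ⊖ varP) varT)
corollary2p8 n M _ k k≤d =
  count≡coeff-sum (independent-of-size? M k) (Y-summand M) (Y-summand-coeff M k≤d) (allSubsets n)
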